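{- For every integer $m\ge1$, the $\mathrm{I}_{mm22}$ inequality \[ -p_{\mathrm{A}_1}-\sum_{j=1}^{m}(m-j)\,p_{\mathrm{B}_j}-\sum_{\substack{2\le i,j\le m\\ i+j=m+2}}p_{\mathrm{A}_i\mathrm{B}_j}+\sum_{\substack{1\le i,j\le m\\ i+j\le m+1}}p_{\mathrm{A}_i\mathrm{B}_j}\le 0 \] defines a facet of the correlation polytope $\mathrm{COR}^\square(\mathrm{K}_{m,m})$ (i.e., it is a tight Bell inequality).
   Context: $\mathrm{K}_{m,m}$ is the complete bipartite graph with node set $V=\{\mathrm{A}_1,\dots,\mathrm{A}_m,\mathrm{B}_1,\dots,\mathrm{B}_m\}$ and edge set $E=\{\mathrm{A}_i\mathrm{B}_j:1\le i,j\le m\}$. For a graph $(V,E)$, the correlation polytope $\mathrm{COR}^\square(V,E)\subseteq\mathbb{R}^{V\cup E}$ is the convex hull of the $2^{\lvert V\rvert}$ vectors $\boldsymbol{p}(S)$, $S\subseteq V$, where $p_u(S)=1$ iff $u\in S$ and $p_{uv}(S)=1$ iff $\{u,v\}\subseteq S$ (entries are $0$ otherwise). An inequality is a facet of a polytope $P$ if it is valid for $P$ and the set of points of $P$ satisfying it with equality has dimension $\dim P-1$. -}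

module Defs where

open import Data.Nat using (ℕ; zero; suc; _∸_; _≤ᵇ_; _≡ᵇ_)
import Data.Nat as ℕ
open import Data.Integer using (+_)
open import Data.Rational using (ℚ; 0ℚ; 1ℚ; -_; _+_; _*_; _-_; _≤_; _/_)
open import Data.Fin using (Fin; zero; suc; toℕ)
open import Data.Bool using (Bool; true; false; if_then_else_; _∧_)
open import Data.List using (List; []; _∷_)
open import Data.Product using (Σ; _×_; _,_)
open import Relation.Binary.PropositionalEquality using (_≡_)
open import Relation.Nullary using (¬_)
open import Data.Unit using (⊤)

-- Coordinates of ℝ^{V ∪ E} for K_{m,m}:
-- a i = node A_{i+1}, b j = node B_{j+1}, ab i j = edge A_{i+1}B_{j+1}  (0-based Fin indices)
data Coord (m : ℕ) : Set where
  a  : Fin m → Coord m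
  b  : Fin m → Coord m
  ab : Fin m → Fin m → Coord m

Point : ℕ → Set
Point m = Coord m → ℚ

sumFin : (n : ℕ) → (Fin n → ℚ) → ℚ
sumFin zero    f = 0ℚ
sumFin (suc n) f = f zero + sumFin n (λ i → f (suc i))

ℕ→ℚ : ℕ → ℚ
ℕ→ℚ n = + n / 1

NodeSubset : ℕ → Set
NodeSubset m = (Fin m → Bool) × (Fin m → Bool)

ind : Bool → ℚ
ind true  = 1ℚ
ind false = 0ℚ

pvec : {m : ℕ} → NodeSubset m → Point m
pvec (sA , sB) (a i)    = ind (sA i)
pvec (sA , sB) (b j)    = ind (sB j)
pvec (sA , sB) (ab i j) = ind (sA i ∧ sB j)

weightSum : {m : ℕ} → List (ℚ × NodeSubset m) → ℚ
weightSum []             = 0ℚ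
weightSum ((l , S) ∷ ws) = l + weightSum ws

combo : {m : ℕ} → List (ℚ × NodeSubset m) → Coord m → ℚ
combo []             c = 0ℚ
combo ((l , S) ∷ ws) c = l * pvec S c + combo ws c

NonNeg : {m : ℕ} → List (ℚ × NodeSubset m) → Set
NonNeg []             = ⊤
NonNeg ((l , S) ∷ ws) = (0ℚ ≤ l) × NonNeg ws

InCOR : (m : ℕ) → Point m → Set
InCOR m x = Σ (List (ℚ × NodeSubset m)) λ ws →
  NonNeg ws × (weightSum ws ≡ 1ℚ) × ((c : Coord m) → combo ws c ≡ x c)

AffIndep : {m : ℕ} (k : ℕ) → (Fin (suc k) → Point m) → Set
AffIndep {m} k pts =
  (coef : Fin k → ℚ) →
  ((c : Coord m) → sumFin k (λ i → coef i * (pts (suc i) c - pts zero c)) ≡ 0ℚ) →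
  (i : Fin k) → coef i ≡ 0ℚ

HasAffIndep : {m : ℕ} → (Point m → Set) → ℕ → Set
HasAffIndep {m} X n =
  Σ (Fin (suc n) → Point m) λ pts → ((i : Fin (suc n)) → X (pts i)) × AffIndep n pts

HasDim : {m : ℕ} → (Point m → Set) → ℕ → Set
HasDim X d = HasAffIndep X d × ¬ HasAffIndep X (suc d)

lin : (m : ℕ) → Point m → Point m → ℚ
lin m α x =
  sumFin m (λ i → α (a i) * x (a i))
  + sumFin m (λ j → α (b j) * x (b j))
  + sumFin m (λ i → sumFin m (λ j → α (ab i j) * x (ab i j)))

IsFacetCOR : (m : ℕ) → Point m → Set
IsFacetCOR m α =
  ((x : Point m) → InCOR m x → lin m α x ≤ 0ℚ)
  × Σ ℕ λ d → HasDim (InCOR m) (suc d)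
              × HasDim (λ x → InCOR m x × (lin m α x ≡ 0ℚ)) d

-- coefficients of I_{mm22} (1-based indices i = toℕ i0 + 1, j = toℕ j0 + 1):
--  p_{A_1}: -1;   p_{B_j}: -(m - j);
--  p_{A_iB_j}: +1 if i + j ≤ m + 1,  -1 if 2 ≤ i,j and i + j = m + 2, 0 otherwise
Immm22 : (m : ℕ) → Point m
Immm22 m (a zero)    = - 1ℚ
Immm22 m (a (suc i)) = 0ℚ
Immm22 m (b j)       = - ℕ→ℚ (m ∸ suc (toℕ j))
Immm22 m (ab i j) =
  if (toℕ i ℕ.+ toℕ j) ≤ᵇ (m ∸ 1) then 1ℚ
  else if (1 ≤ᵇ toℕ i) ∧ (1 ≤ᵇ toℕ j) ∧ ((toℕ i ℕ.+ toℕ j) ≡ᵇ m) then - 1ℚ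
  else 0ℚ

-- Deleting the nodes A_{m+1} and B_1 of K_{m+1,m+1} leaves K_{m,m}, and there the inequality I_{m+1,m+1,2,2}
-- becomes I_mm22 plus the boundary term  −m p_{B_1} + Σ_i p_{A_i B_1} − p_{A_{m+1} B_2}  (lin-Immm22-restrict);
-- everything is proved by induction on m along this decomposition.
-- Validity: at a vertex p(S) the boundary term is ≤ 0 unless S contains B_1 and all of A, and for those S the
-- whole value is −1 + [B_1 ∈ S] = 0.
-- Facet: the tight vertices for m, lifted so that A_{m+1}, B_1 ∉ S, stay tight, and 2m+3 new tight vertices are
-- triangular with respect to the coordinate functionals x_{B_1} − x_{A_k B_1}, x_{A_{m+1} B_{j+2}}, x_{B_1} and
-- x_{A_{m+1}}, which all vanish on the lifted ones. This gives m² + 2m − 1 linearly independent tight vertices, so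
-- with the origin the face has dimension m² + 2m − 1. The vertex p({A_1}), of value −1, raises this by one to
-- m² + 2m = |V ∪ E|, which no affinely independent family can exceed (Gaussian elimination).

module Submission where

open import Defs
open import Data.Nat as ℕ using (ℕ; zero; suc; _≥_; _≤ᵇ_; _≡ᵇ_; z≤n; s≤s)
import Data.Nat.Properties as ℕ
import Data.Nat.Coprimality as Coprimality
import Data.Nat.Solver as ℕ-Solver
import Data.Integer as ℤ
import Data.Integer.Properties as ℤ
open import Data.Rational as ℚ using (ℚ; 0ℚ; 1ℚ; -_; _+_; _*_; _-_; 1/_)
import Data.Rational.Properties as ℚ
open import Data.Rational.Solver using (module +-*-Solver)
open import Data.Fin as Fin using (Fin; zero; suc; toℕ; inject₁; fromℕ; punchIn; splitAt)
import Data.Fin.Properties as Fin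
open import Data.Vec.Functional as Vec using (Vector; _++_; head; tail; init; last; insertAt; removeAt)
open import Data.Vec.Functional.Properties using (insertAt-lookup; insertAt-punchIn; ++-cong)
open import Data.List as List using (List; []; _∷_; length; allFin; cartesianProductWith)
open import Data.List.Properties using (length-++; length-map; length-tabulate)
open import Data.List.Membership.Propositional using (_∈_)
open import Data.List.Membership.Propositional.Properties
  using (∈-++⁺ˡ; ∈-++⁺ʳ; ∈-map⁺; ∈-allFin; ∈-cartesianProductWith⁺)
open import Data.List.Relation.Unary.Any using (here; there)
open import Data.Unit using (tt)
open import Data.Product using (Σ; _×_; _,_; proj₁; proj₂)
open import Data.Sum using (inj₁; inj₂)
open import Function using (_∘_; const)
open import Relation.Nullary using (¬_; yes; no; does)
open import Relation.Nullary.Decidable using (dec-true; dec-false)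
open import Data.Bool using (Bool; true; false; if_then_else_; _∧_; not)
import Data.Bool.Properties as Bool
open import Relation.Binary.PropositionalEquality
open import Algebra.Bundles using (Ring)
open import Algebra.Properties.Semiring.Sum (Ring.semiring ℚ.+-*-ring)
  using (sum; sum-remove; sum-init-last; ∑-distrib-+; *-distribˡ-sum)

open +-*-Solver
open ≡-Reasoning

-- ℕ→ℚ n = + n / 1 normalises to mkℚ (+ n) 0 _, on which addition computes.
ℕ→ℚ-suc : ∀ n → ℕ→ℚ (suc n) ≡ 1ℚ + ℕ→ℚ n
ℕ→ℚ-suc n = sym (trans (cong (1ℚ +_) (ℚ.normalize-coprime (Coprimality.sym (Coprimality.1-coprimeTo n))))
                       (ℚ./-cong (cong (ℤ._+_ (ℤ.+ 1)) (trans (ℤ.+◃n≡+n (n ℕ.* 1)) (cong ℤ.+_ (ℕ.*-identityʳ n)))) refl))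

1≢0 : 1ℚ ≢ 0ℚ
1≢0 ()

-1≢0 : - 1ℚ ≢ 0ℚ
-1≢0 ()

p*q≡0⇒p≡0 : ∀ {p q} → q ≢ 0ℚ → p * q ≡ 0ℚ → p ≡ 0ℚ
p*q≡0⇒p≡0 {p} {q} q≢0 pq≡0 = begin
  p                 ≡⟨ sym (ℚ.*-identityʳ p) ⟩
  p * 1ℚ            ≡⟨ cong (p *_) (sym (ℚ.*-inverseʳ q)) ⟩
  p * (q * 1/ q)    ≡⟨ sym (ℚ.*-assoc p q (1/ q)) ⟩
  p * q * 1/ q      ≡⟨ cong (_* 1/ q) pq≡0 ⟩
  0ℚ * 1/ q         ≡⟨ ℚ.*-zeroˡ (1/ q) ⟩
  0ℚ                ∎
  where instance _ = ℚ.≢-nonZero q≢0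

0≤ind : ∀ x → 0ℚ ℚ.≤ ind x
0≤ind true  = ℚ.*≤* (ℤ.+≤+ z≤n)
0≤ind false = ℚ.≤-refl

sumFin≡sum : ∀ n (f : Fin n → ℚ) → sumFin n f ≡ sum f
sumFin≡sum zero    f = refl
sumFin≡sum (suc n) f = cong (f zero +_) (sumFin≡sum n (tail f))

sumFin-cong : ∀ n {f g : Fin n → ℚ} → (∀ i → f i ≡ g i) → sumFin n f ≡ sumFin n g
sumFin-cong zero    f≗g = refl
sumFin-cong (suc n) f≗g = cong₂ _+_ (f≗g zero) (sumFin-cong n (f≗g ∘ suc))

sumFin-const : ∀ n c → sumFin n (λ _ → c) ≡ ℕ→ℚ n * c
sumFin-const zero    c = sym (ℚ.*-zeroˡ c)
sumFin-const (suc n) c = begin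
  c + sumFin n (λ _ → c)  ≡⟨ cong (c +_) (sumFin-const n c) ⟩
  c + ℕ→ℚ n * c           ≡⟨ solve 2 (λ c k → c :+ k :* c := (con 1ℚ :+ k) :* c) refl c (ℕ→ℚ n) ⟩
  (1ℚ + ℕ→ℚ n) * c        ≡⟨ cong (_* c) (ℕ→ℚ-suc n) ⟨
  ℕ→ℚ (suc n) * c         ∎

sumFin-zero : ∀ n {f : Fin n → ℚ} → (∀ i → f i ≡ 0ℚ) → sumFin n f ≡ 0ℚ
sumFin-zero n f≗0 = trans (sumFin-cong n f≗0) (trans (sumFin-const n 0ℚ) (ℚ.*-zeroʳ (ℕ→ℚ n)))

sumFin-*-zero : ∀ n (f : Fin n → ℚ) {g : Fin n → ℚ} → (∀ i → g i ≡ 0ℚ) → sumFin n (λ i → f i * g i) ≡ 0ℚ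
sumFin-*-zero n f g≗0 = sumFin-zero n (λ i → trans (cong (f i *_) (g≗0 i)) (ℚ.*-zeroʳ (f i)))

sumFin-+ : ∀ n (f g : Fin n → ℚ) → sumFin n (λ i → f i + g i) ≡ sumFin n f + sumFin n g
sumFin-+ n f g = begin
  sumFin n (λ i → f i + g i)  ≡⟨ sumFin≡sum n _ ⟩
  sum (λ i → f i + g i)       ≡⟨ ∑-distrib-+ f g ⟩
  sum f + sum g               ≡⟨ cong₂ _+_ (sumFin≡sum n f) (sumFin≡sum n g) ⟨
  sumFin n f + sumFin n g     ∎

sumFin-*ˡ : ∀ n c (f : Fin n → ℚ) → c * sumFin n f ≡ sumFin n (λ i → c * f i)
sumFin-*ˡ n c f = begin
  c * sumFin n f           ≡⟨ cong (c *_) (sumFin≡sum n f) ⟩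
  c * sum f                ≡⟨ *-distribˡ-sum c f ⟩
  sum (λ i → c * f i)      ≡⟨ sumFin≡sum n _ ⟨
  sumFin n (λ i → c * f i) ∎

sumFin-remove : ∀ n (p : Fin (suc n)) (f : Fin (suc n) → ℚ) → sumFin (suc n) f ≡ f p + sumFin n (removeAt f p)
sumFin-remove n p f = begin
  sumFin (suc n) f               ≡⟨ sumFin≡sum (suc n) f ⟩
  sum f                          ≡⟨ sum-remove f ⟩
  f p + sum (removeAt f p)       ≡⟨ cong (f p +_) (sumFin≡sum n _) ⟨
  f p + sumFin n (removeAt f p)  ∎

sumFin-init-last : ∀ n (f : Fin (suc n) → ℚ) → sumFin (suc n) f ≡ sumFin n (init f) + last f
sumFin-init-last n f = begin
  sumFin (suc n) f          ≡⟨ sumFin≡sum (suc n) f ⟩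
  sum f                     ≡⟨ sum-init-last f ⟩
  sum (init f) + last f     ≡⟨ cong (_+ last f) (sumFin≡sum n _) ⟨
  sumFin n (init f) + last f ∎

sumFin-−-*ʳ : ∀ n (f g : Fin n → ℚ) w → sumFin n (λ i → f i - g i * w) ≡ sumFin n f - sumFin n g * w
sumFin-−-*ʳ n f g w = begin
  sumFin n (λ i → f i - g i * w)
    ≡⟨ sumFin-cong n (λ i → solve 3 (λ f g w → f :- g :* w := f :+ (:- w) :* g) refl (f i) (g i) w) ⟩
  sumFin n (λ i → f i + - w * g i)
    ≡⟨ sumFin-+ n f _ ⟩
  sumFin n f + sumFin n (λ i → - w * g i)
    ≡⟨ cong (sumFin n f +_) (sumFin-*ˡ n (- w) g) ⟨
  sumFin n f + - w * sumFin n g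
    ≡⟨ solve 3 (λ F G w → F :+ (:- w) :* G := F :- G :* w) refl (sumFin n f) (sumFin n g) w ⟩
  sumFin n f - sumFin n g * w
    ∎

++-all : ∀ {A : Set} {P : A → Set} {r s} (xs : Vector A r) (ys : Vector A s) →
         (∀ i → P (xs i)) → (∀ j → P (ys j)) → ∀ i → P ((xs ++ ys) i)
++-all {r = r} xs ys Pxs Pys i with splitAt r i
... | inj₁ j = Pxs j
... | inj₂ j = Pys j

map-++ : ∀ {A B : Set} {r s} (f : A → B) (xs : Vector A r) (ys : Vector A s) i →
         f ((xs ++ ys) i) ≡ ((f ∘ xs) ++ (f ∘ ys)) i
map-++ {r = r} f xs ys i with splitAt r i
... | inj₁ j = refl
... | inj₂ j = refl

++-head-tail : ∀ {A : Set} {r s} (xs : Vector A (suc r)) (ys : Vector A s) i →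
               (xs ++ ys) i ≡ (head xs Vec.∷ (tail xs ++ ys)) i
++-head-tail xs ys zero = refl
++-head-tail {r = r} xs ys (suc i) with splitAt r i
... | inj₁ j = refl
... | inj₂ j = refl

snoc : ∀ {A : Set} {n} → Vector A n → A → Vector A (suc n)
snoc {n = zero}  xs x = const x
snoc {n = suc n} xs x = head xs Vec.∷ snoc (tail xs) x

snoc-inject₁ : ∀ {A : Set} {n} (xs : Vector A n) x i → snoc xs x (inject₁ i) ≡ xs i
snoc-inject₁ {n = suc n} xs x zero    = refl
snoc-inject₁ {n = suc n} xs x (suc i) = snoc-inject₁ (tail xs) x i

snoc-last : ∀ {A : Set} {n} (xs : Vector A n) x → snoc xs x (fromℕ n) ≡ x
snoc-last {n = zero}  xs x = refl
snoc-last {n = suc n} xs x = snoc-last (tail xs) x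

data LastOrInject₁ : ∀ {n} → Fin (suc n) → Set where
  last-view    : ∀ {n} → LastOrInject₁ (fromℕ n)
  inject₁-view : ∀ {n} (i : Fin n) → LastOrInject₁ (inject₁ i)

last-or-inject₁ : ∀ {n} (i : Fin (suc n)) → LastOrInject₁ i
last-or-inject₁ {zero}  zero    = last-view
last-or-inject₁ {suc n} zero    = inject₁-view zero
last-or-inject₁ {suc n} (suc i) with last-or-inject₁ i
... | last-view      = last-view
... | inject₁-view j = inject₁-view (suc j)

does-inject₁-≟ : ∀ {n} (i j : Fin n) → does (inject₁ i Fin.≟ inject₁ j) ≡ does (i Fin.≟ j)
does-inject₁-≟ i j with i Fin.≟ j
... | yes refl = dec-true (inject₁ i Fin.≟ inject₁ i) refl
... | no  i≢j  = dec-false (inject₁ i Fin.≟ inject₁ j) (i≢j ∘ Fin.inject₁-injective)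

≢∧toℕ≡-false : ∀ {n} (x y : Fin n) {c} → toℕ x ≡ c → (not (does (x Fin.≟ y)) ∧ does (toℕ y ℕ.≟ c)) ≡ false
≢∧toℕ≡-false x y {c} toℕx≡c with x Fin.≟ y
... | yes _   = refl
... | no  x≢y = dec-false (toℕ y ℕ.≟ c) (λ toℕy≡c → x≢y (Fin.toℕ-injective (trans toℕx≡c (sym toℕy≡c))))

-- Linear independence over ℚ

module _ {C : Set} where

  combination : ∀ {k} → Vector ℚ k → Vector (C → ℚ) k → C → ℚ
  combination {k} coef vs c = sumFin k (λ i → coef i * vs i c)

  LinearlyIndependent : ∀ k → Vector (C → ℚ) k → Set
  LinearlyIndependent k vs = ∀ coef → (∀ c → combination coef vs c ≡ 0ℚ) → ∀ i → coef i ≡ 0ℚ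

  independent-resp : ∀ {k} {vs ws : Vector (C → ℚ) k} → (∀ i c → vs i c ≡ ws i c) →
                     LinearlyIndependent k vs → LinearlyIndependent k ws
  independent-resp {k} vs≗ws vs-ind coef rel =
    vs-ind coef (λ c → trans (sumFin-cong k (λ i → cong (coef i *_) (vs≗ws i c))) (rel c))

  -- Linearity is phrased through relations, so that no function extensionality is needed.
  record Linear (φ : (C → ℚ) → ℚ) : Set where
    constructor linear
    field
      preserves-relations : ∀ {k} coef (vs : Vector (C → ℚ) k) →
        (∀ c → combination coef vs c ≡ 0ℚ) → sumFin k (λ i → coef i * φ (vs i)) ≡ 0ℚ

  open Linear

  zero-linear : Linear (λ _ → 0ℚ)
  zero-linear = linear (λ {k} coef vs _ → sumFin-*-zero k coef (λ _ → refl))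

  evaluation-linear : ∀ c → Linear (λ x → x c)
  evaluation-linear c = linear (λ coef vs rel → rel c)

  scale-linear : ∀ r {φ} → Linear φ → Linear (λ x → r * φ x)
  scale-linear r {φ} φ-lin = linear λ {k} coef vs rel → begin
    sumFin k (λ i → coef i * (r * φ (vs i)))  ≡⟨ sumFin-cong k (λ i → swap (coef i) (φ (vs i))) ⟩
    sumFin k (λ i → r * (coef i * φ (vs i)))  ≡⟨ sumFin-*ˡ k r _ ⟨
    r * sumFin k (λ i → coef i * φ (vs i))    ≡⟨ cong (r *_) (preserves-relations φ-lin coef vs rel) ⟩
    r * 0ℚ                                    ≡⟨ ℚ.*-zeroʳ r ⟩
    0ℚ                                        ∎
    where
    swap : ∀ p q → p * (r * q) ≡ r * (p * q)
    swap p q = solve 3 (λ p r q → p :* (r :* q) := r :* (p :* q)) refl p r q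

  +-linear : ∀ {φ ψ} → Linear φ → Linear ψ → Linear (λ x → φ x + ψ x)
  +-linear {φ} {ψ} φ-lin ψ-lin = linear λ {k} coef vs rel → begin
    sumFin k (λ i → coef i * (φ (vs i) + ψ (vs i)))         ≡⟨ sumFin-cong k (λ i → ℚ.*-distribˡ-+ (coef i) _ _) ⟩
    sumFin k (λ i → coef i * φ (vs i) + coef i * ψ (vs i))  ≡⟨ sumFin-+ k _ _ ⟩
    sumFin k (λ i → coef i * φ (vs i)) + sumFin k (λ i → coef i * ψ (vs i))
                   ≡⟨ cong₂ _+_ (preserves-relations φ-lin coef vs rel) (preserves-relations ψ-lin coef vs rel) ⟩
    0ℚ + 0ℚ                                                 ≡⟨ ℚ.+-identityˡ 0ℚ ⟩
    0ℚ                                                      ∎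

  −-linear : ∀ {φ ψ} → Linear φ → Linear ψ → Linear (λ x → φ x - ψ x)
  −-linear {φ} {ψ} φ-lin ψ-lin = linear λ {k} coef vs rel → begin
    sumFin k (λ i → coef i * (φ (vs i) - ψ (vs i)))
      ≡⟨ sumFin-cong k (λ i → minus (coef i) (φ (vs i)) (ψ (vs i))) ⟩
    sumFin k (λ i → coef i * (φ (vs i) + - 1ℚ * ψ (vs i)))
      ≡⟨ preserves-relations (+-linear φ-lin (scale-linear (- 1ℚ) ψ-lin)) coef vs rel ⟩
    0ℚ
      ∎
    where
    minus : ∀ c p q → c * (p - q) ≡ c * (p + - 1ℚ * q)
    minus c p q = solve 3 (λ c p q → c :* (p :- q) := c :* (p :+ con (- 1ℚ) :* q)) refl c p q

  sumFin-linear : ∀ n {φ : Fin n → (C → ℚ) → ℚ} → (∀ t → Linear (φ t)) → Linear (λ x → sumFin n (λ t → φ t x))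
  sumFin-linear zero    _     = zero-linear
  sumFin-linear (suc n) φ-lin = +-linear (φ-lin zero) (sumFin-linear n (φ-lin ∘ suc))

  linear-combination₂ : ∀ {φ} → Linear φ → ∀ r s x y {z} → (∀ c → z c ≡ r * x c + s * y c) → φ z ≡ r * φ x + s * φ y
  linear-combination₂ {φ} φ-lin r s x y {z} z≗rx+sy = begin
    φ z
      ≡⟨ solve 5 (λ Z X Y r s → Z := (con 1ℚ :* Z :+ ((:- r) :* X :+ ((:- s) :* Y :+ con 0ℚ))) :+ (r :* X :+ s :* Y))
               refl (φ z) (φ x) (φ y) r s ⟩
    (1ℚ * φ z + (- r * φ x + (- s * φ y + 0ℚ))) + (r * φ x + s * φ y)
      ≡⟨ cong (_+ (r * φ x + s * φ y))
              (preserves-relations φ-lin (1ℚ Vec.∷ - r Vec.∷ - s Vec.∷ Vec.[]) (z Vec.∷ x Vec.∷ y Vec.∷ Vec.[]) rel) ⟩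
    0ℚ + (r * φ x + s * φ y)
      ≡⟨ ℚ.+-identityˡ _ ⟩
    r * φ x + s * φ y
      ∎
    where
    rel : ∀ c → 1ℚ * z c + (- r * x c + (- s * y c + 0ℚ)) ≡ 0ℚ
    rel c rewrite z≗rx+sy c =
      solve 4 (λ r s X Y → con 1ℚ :* (r :* X :+ s :* Y) :+ ((:- r) :* X :+ ((:- s) :* Y :+ con 0ℚ)) := con 0ℚ) refl r s (x c) (y c)

  linear-cong : ∀ {φ} → Linear φ → ∀ x y → (∀ c → x c ≡ y c) → φ x ≡ φ y
  linear-cong {φ} φ-lin x y x≗y =
    trans (linear-combination₂ φ-lin 1ℚ 0ℚ y y (λ c → trans (x≗y c) (as-combination (y c)))) (sym (as-combination (φ y)))
    where
    as-combination : ∀ q → q ≡ 1ℚ * q + 0ℚ * q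
    as-combination q = solve 1 (λ q → q := con 1ℚ :* q :+ con 0ℚ :* q) refl q

  linear-zero : ∀ {φ} → Linear φ → ∀ x → (∀ c → x c ≡ 0ℚ) → φ x ≡ 0ℚ
  linear-zero {φ} φ-lin x x≗0 =
    trans (linear-combination₂ φ-lin 0ℚ 0ℚ x x (λ c → trans (x≗0 c) (vanishing (x c)))) (sym (vanishing (φ x)))
    where
    vanishing : ∀ q → 0ℚ ≡ 0ℚ * q + 0ℚ * q
    vanishing q = solve 1 (λ q → con 0ℚ := con 0ℚ :* q :+ con 0ℚ :* q) refl q

  linear-− : ∀ {φ} → Linear φ → ∀ x y → φ (λ c → x c - y c) ≡ φ x - φ y
  linear-− {φ} φ-lin x y = begin
    φ (λ c → x c - y c)
      ≡⟨ linear-combination₂ φ-lin 1ℚ (- 1ℚ) x y (λ c → as-combination (x c) (y c)) ⟩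
    1ℚ * φ x + - 1ℚ * φ y
      ≡⟨ as-combination (φ x) (φ y) ⟨
    φ x - φ y
      ∎
    where
    as-combination : ∀ p q → p - q ≡ 1ℚ * p + - 1ℚ * q
    as-combination p q = solve 2 (λ p q → p :- q := con 1ℚ :* p :+ con (- 1ℚ) :* q) refl p q

  -- Gaussian elimination of the coordinate c against the pivot vector vs p.
  pivot : ∀ {k} → Vector (C → ℚ) (suc k) → C → Fin (suc k) → Vector (C → ℚ) k
  pivot vs c p i x = vs p c * vs (punchIn p i) x - vs (punchIn p i) c * vs p x

  pivot-vanishes : ∀ {k} (vs : Vector (C → ℚ) (suc k)) c p i → pivot vs c p i c ≡ 0ℚ
  pivot-vanishes vs c p i = solve 2 (λ v w → v :* w :- w :* v := con 0ℚ) refl (vs p c) (vs (punchIn p i) c)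

  unpivot : ∀ {k} → Vector (C → ℚ) (suc k) → C → Fin (suc k) → Vector ℚ k → Vector ℚ (suc k)
  unpivot vs c p coef = insertAt (λ i → coef i * vs p c) p (- combination coef (removeAt vs p) c)

  combination-unpivot : ∀ {k} (vs : Vector (C → ℚ) (suc k)) c p coef x →
                        combination (unpivot vs c p coef) vs x ≡ combination coef (pivot vs c p) x
  combination-unpivot {k} vs c p coef x = begin
    combination U vs x
      ≡⟨ sumFin-remove k p (λ j → U j * vs j x) ⟩
    U p * w + sumFin k (λ i → U (punchIn p i) * V i x)
      ≡⟨ cong₂ (λ u f → u * w + f) (insertAt-lookup _ p _) (sumFin-cong k (λ i → cong (_* V i x) (insertAt-punchIn _ p _ i))) ⟩
    - S * w + sumFin k (λ i → coef i * v * V i x)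
      ≡⟨ solve 3 (λ S w A → (:- S) :* w :+ A := A :- S :* w) refl S w _ ⟩
    sumFin k (λ i → coef i * v * V i x) - S * w
      ≡⟨ sumFin-−-*ʳ k _ _ w ⟨
    sumFin k (λ i → coef i * v * V i x - coef i * V i c * w)
      ≡⟨ sumFin-cong k (λ i → solve 5 (λ κ v X Y w → κ :* v :* X :- κ :* Y :* w := κ :* (v :* X :- Y :* w))
                                      refl (coef i) v (V i x) (V i c) w) ⟩
    combination coef (pivot vs c p) x
      ∎
    where
    U : Vector ℚ (suc k)
    U = unpivot vs c p coef
    V : Vector (C → ℚ) k
    V = removeAt vs p
    v w S : ℚ
    v = vs p c
    w = vs p x
    S = combination coef V c

  nontrivial-relation : ∀ (cs : List C) {k} (vs : Vector (C → ℚ) k) → length cs ℕ.< k →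
    Σ (Vector ℚ k) λ coef → (Σ (Fin k) λ i → coef i ≢ 0ℚ) × (∀ {c} → c ∈ cs → combination coef vs c ≡ 0ℚ)
  nontrivial-relation [] {suc k} vs _ = (λ _ → 1ℚ) , (zero , λ ()) , λ ()
  nontrivial-relation (c ∷ cs) {suc k} vs (s≤s |cs|<k) with Fin.all? (λ i → vs i c ℚ.≟ 0ℚ)
  ... | yes vs≗0 =
    let coef , nonzero , rel = nontrivial-relation cs vs (ℕ.m≤n⇒m≤1+n |cs|<k)
        rel-c = sumFin-*-zero (suc k) coef vs≗0
    in coef , nonzero , λ { (here refl) → rel-c ; (there c′∈cs) → rel c′∈cs }
  ... | no vs≉0 =
    let p , vₚ≢0 = Fin.¬∀⟶∃¬ (suc k) _ (λ i → vs i c ℚ.≟ 0ℚ) vs≉0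
        coef , (i , coefᵢ≢0) , rel = nontrivial-relation cs (pivot vs c p) |cs|<k
        rel-c = trans (combination-unpivot vs c p coef c) (sumFin-*-zero k coef (pivot-vanishes vs c p))
    in unpivot vs c p coef
       , (punchIn p i , λ e → coefᵢ≢0 (p*q≡0⇒p≡0 vₚ≢0 (trans (sym (insertAt-punchIn _ p _ i)) e)))
       , λ { (here refl) → rel-c ; (there c′∈cs) → trans (combination-unpivot vs c p coef _) (rel c′∈cs) }

  independent⇒≤length : (cs : List C) → (∀ c → c ∈ cs) →
                        ∀ {k vs} → LinearlyIndependent k vs → k ℕ.≤ length cs
  independent⇒≤length cs complete {k} {vs} vs-ind = ℕ.≮⇒≥ λ |cs|<k →
    let coef , (i , coefᵢ≢0) , rel = nontrivial-relation cs vs |cs|<k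
    in coefᵢ≢0 (vs-ind coef (rel ∘ complete) i)

  independent-∷ : ∀ {k φ v} {ws : Vector (C → ℚ) k} → Linear φ → φ v ≢ 0ℚ → (∀ i → φ (ws i) ≡ 0ℚ) →
                  LinearlyIndependent k ws → LinearlyIndependent (suc k) (v Vec.∷ ws)
  independent-∷ {k} {φ} {v} {ws} φ-lin φv≢0 φws≡0 ws-ind coef rel = λ
    { zero    → head-coef≡0
    ; (suc i) → ws-ind (tail coef) tail-rel i }
    where
    head-coef≡0 : coef zero ≡ 0ℚ
    head-coef≡0 = p*q≡0⇒p≡0 φv≢0 (begin
      coef zero * φ v                                    ≡⟨ ℚ.+-identityʳ _ ⟨
      coef zero * φ v + 0ℚ                               ≡⟨ cong (coef zero * φ v +_) (sumFin-*-zero k (tail coef) φws≡0) ⟨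
      sumFin (suc k) (λ i → coef i * φ ((v Vec.∷ ws) i)) ≡⟨ preserves-relations φ-lin coef (v Vec.∷ ws) rel ⟩
      0ℚ                                                 ∎)
    tail-rel : ∀ c → combination (tail coef) ws c ≡ 0ℚ
    tail-rel c = begin
      combination (tail coef) ws c
        ≡⟨ ℚ.+-identityˡ _ ⟨
      0ℚ + combination (tail coef) ws c
        ≡⟨ cong (_+ combination (tail coef) ws c) (trans (cong (_* v c) head-coef≡0) (ℚ.*-zeroˡ (v c))) ⟨
      coef zero * v c + combination (tail coef) ws c
        ≡⟨ rel c ⟩
      0ℚ
        ∎

  independent-++ : ∀ {r s} (φ : Vector ((C → ℚ) → ℚ) r) {us : Vector (C → ℚ) r} {ws : Vector (C → ℚ) s} →
                   (∀ t → Linear (φ t)) → (∀ t → φ t (us t) ≢ 0ℚ) →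
                   (∀ {t t′} → t Fin.< t′ → φ t (us t′) ≡ 0ℚ) → (∀ t i → φ t (ws i) ≡ 0ℚ) →
                   LinearlyIndependent s ws → LinearlyIndependent (r ℕ.+ s) (us ++ ws)
  independent-++ {zero}  φ         φ-lin φus≢0 φus≡0 φws≡0 ws-ind = ws-ind
  independent-++ {suc r} φ {us} {ws} φ-lin φus≢0 φus≡0 φws≡0 ws-ind =
    independent-resp (λ i c → cong (λ u → u c) (sym (++-head-tail us ws i)))
      (independent-∷ (φ-lin zero) (φus≢0 zero)
        (++-all {P = λ u → φ zero u ≡ 0ℚ} (tail us) ws (λ t → φus≡0 (s≤s z≤n)) (φws≡0 zero))
        (independent-++ (tail φ) (φ-lin ∘ suc) (φus≢0 ∘ suc) (λ t<t′ → φus≡0 (s≤s t<t′)) (φws≡0 ∘ suc) ws-ind))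

independent-restriction : ∀ {C D : Set} (e : D → C) {k} {vs : Vector (D → ℚ) k} {ws : Vector (C → ℚ) k} →
                          (∀ i d → ws i (e d) ≡ vs i d) → LinearlyIndependent k vs → LinearlyIndependent k ws
independent-restriction e {k} ws∘e≗vs vs-ind coef rel =
  vs-ind coef (λ d → trans (sumFin-cong k (λ i → cong (coef i *_) (sym (ws∘e≗vs i d)))) (rel (e d)))

-- Affine dimension and the polytope

affine-extend : ∀ {m k φ} (pts : Fin (suc k) → Point m) y → Linear φ → (∀ i → φ (pts i) ≡ 0ℚ) → φ y ≢ 0ℚ →
                AffIndep k pts → AffIndep (suc k) (pts zero Vec.∷ y Vec.∷ tail pts)
affine-extend {φ = φ} pts y φ-lin φpts≡0 φy≢0 = independent-∷ φ-lin φ[y-p₀]≢0 φ[pᵢ-p₀]≡0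
  where
  φ[pᵢ-p₀]≡0 : ∀ i → φ (λ c → pts (suc i) c - pts zero c) ≡ 0ℚ
  φ[pᵢ-p₀]≡0 i = trans (linear-− φ-lin _ _) (cong₂ _-_ (φpts≡0 (suc i)) (φpts≡0 zero))
  φ[y-p₀]≢0 : φ (λ c → y c - pts zero c) ≢ 0ℚ
  φ[y-p₀]≢0 e = φy≢0 (begin
    φ y                             ≡⟨ ℚ.+-identityʳ (φ y) ⟨
    φ y - 0ℚ                        ≡⟨ cong (_-_ (φ y)) (φpts≡0 zero) ⟨
    φ y - φ (pts zero)              ≡⟨ linear-− φ-lin y (pts zero) ⟨
    φ (λ c → y c - pts zero c)      ≡⟨ e ⟩
    0ℚ                              ∎)

affine-from-origin : ∀ {m k} (o : Point m) (vs : Vector (Point m) k) → (∀ c → o c ≡ 0ℚ) →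
                     LinearlyIndependent k vs → AffIndep k (o Vec.∷ vs)
affine-from-origin o vs o≗0 =
  independent-resp λ i c → trans (sym (ℚ.+-identityʳ (vs i c))) (cong (λ z → vs i c - z) (sym (o≗0 c)))

hyperplane-section-dimensions : ∀ {m} (X : Point m → Set) {φ : Point m → ℚ} d → Linear φ →
  (y : Point m) → X y → φ y ≢ 0ℚ → ¬ HasAffIndep X (suc (suc d)) →
  HasAffIndep (λ x → X x × φ x ≡ 0ℚ) d →
  HasDim X (suc d) × HasDim (λ x → X x × φ x ≡ 0ℚ) d
hyperplane-section-dimensions X {φ} d φ-lin y Xy φy≢0 X-bound section =
  (extend section , X-bound) , (section , X-bound ∘ extend)
  where
  extend : ∀ {k} → HasAffIndep (λ x → X x × φ x ≡ 0ℚ) k → HasAffIndep X (suc k)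
  extend (pts , pts∈ , pts-ind) =
    (pts zero Vec.∷ y Vec.∷ tail pts) ,
    (λ { zero → proj₁ (pts∈ zero) ; (suc zero) → Xy ; (suc (suc i)) → proj₁ (pts∈ (suc i)) }) ,
    affine-extend pts y φ-lin (proj₂ ∘ pts∈) φy≢0 pts-ind

length-cartesianProductWith : ∀ {A B C : Set} (f : A → B → C) xs ys →
                              length (cartesianProductWith f xs ys) ≡ length xs ℕ.* length ys
length-cartesianProductWith f []       ys = refl
length-cartesianProductWith f (x ∷ xs) ys = begin
  length (List.map (f x) ys List.++ cartesianProductWith f xs ys)
    ≡⟨ length-++ (List.map (f x) ys) ⟩
  length (List.map (f x) ys) ℕ.+ length (cartesianProductWith f xs ys)
    ≡⟨ cong₂ ℕ._+_ (length-map (f x) ys) (length-cartesianProductWith f xs ys) ⟩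
  length ys ℕ.+ length xs ℕ.* length ys
    ∎

coordinates : ∀ m → List (Coord m)
coordinates m = List.map a (allFin m) List.++ (List.map b (allFin m) List.++ cartesianProductWith ab (allFin m) (allFin m))

∈-coordinates : ∀ {m} (c : Coord m) → c ∈ coordinates m
∈-coordinates (a i)    = ∈-++⁺ˡ (∈-map⁺ a (∈-allFin i))
∈-coordinates {m} (b j)    = ∈-++⁺ʳ (List.map a (allFin m)) (∈-++⁺ˡ (∈-map⁺ b (∈-allFin j)))
∈-coordinates {m} (ab i j) = ∈-++⁺ʳ (List.map a (allFin m)) (∈-++⁺ʳ (List.map b (allFin m))
                               (∈-cartesianProductWith⁺ ab (∈-allFin i) (∈-allFin j)))

length-coordinates : ∀ m → length (coordinates m) ≡ m ℕ.+ (m ℕ.+ m ℕ.* m)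
length-coordinates m = begin
  length (coordinates m)
    ≡⟨ length-++ (List.map a (allFin m)) ⟩
  length (List.map a (allFin m)) ℕ.+ length (List.map b (allFin m) List.++ cartesianProductWith ab (allFin m) (allFin m))
    ≡⟨ cong (length (List.map a (allFin m)) ℕ.+_) (length-++ (List.map b (allFin m))) ⟩
  length (List.map a (allFin m)) ℕ.+ (length (List.map b (allFin m)) ℕ.+ length (cartesianProductWith ab (allFin m) (allFin m)))
    ≡⟨ cong₂ (λ p q → p ℕ.+ (q ℕ.+ length (cartesianProductWith ab (allFin m) (allFin m)))) (|map| a) (|map| b) ⟩
  m ℕ.+ (m ℕ.+ length (cartesianProductWith ab (allFin m) (allFin m)))
    ≡⟨ cong (λ p → m ℕ.+ (m ℕ.+ p))
            (trans (length-cartesianProductWith ab (allFin m) (allFin m)) (cong₂ ℕ._*_ |allFin| |allFin|)) ⟩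
  m ℕ.+ (m ℕ.+ m ℕ.* m)
    ∎
  where
  |allFin| : length (allFin m) ≡ m
  |allFin| = length-tabulate (λ i → i)
  |map| : ∀ {A : Set} (f : Fin m → A) → length (List.map f (allFin m)) ≡ m
  |map| f = trans (length-map f (allFin m)) |allFin|

affine-dimension-bound : ∀ {m} (X : Point m → Set) k → m ℕ.+ (m ℕ.+ m ℕ.* m) ℕ.< k → ¬ HasAffIndep X k
affine-dimension-bound {m} X k |coordinates|<k (_ , _ , pts-ind) =
  ℕ.<⇒≱ |coordinates|<k
    (subst (k ℕ.≤_) (length-coordinates m) (independent⇒≤length (coordinates m) ∈-coordinates pts-ind))

lin-linear : ∀ m α → Linear (lin m α)
lin-linear m α = +-linear (+-linear (weighted a) (weighted b)) (sumFin-linear m (λ i → weighted (ab i)))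
  where
  weighted : ∀ {n} (e : Fin n → Coord m) → Linear (λ x → sumFin n (λ t → α (e t) * x (e t)))
  weighted e = sumFin-linear _ (λ t → scale-linear (α (e t)) (evaluation-linear (e t)))

vertex-in-COR : ∀ {m} (S : NodeSubset m) → InCOR m (pvec S)
vertex-in-COR S = ((1ℚ , S) ∷ []) , (0≤ind true , tt) , refl , λ c → trans (ℚ.+-identityʳ _) (ℚ.*-identityˡ (pvec S c))

valid-on-COR : ∀ {m φ} → Linear φ → (∀ S → φ (pvec S) ℚ.≤ 0ℚ) → ∀ x → InCOR m x → φ x ℚ.≤ 0ℚ
valid-on-COR {φ = φ} φ-lin vertices≤0 x (ws , ws≥0 , _ , combo≗x) =
  subst (ℚ._≤ 0ℚ) (linear-cong φ-lin (combo ws) x combo≗x) (combo≤0 ws ws≥0)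
  where
  combo≤0 : ∀ ws → NonNeg ws → φ (combo ws) ℚ.≤ 0ℚ
  combo≤0 []             _          = ℚ.≤-reflexive (linear-zero φ-lin (combo []) (λ _ → refl))
  combo≤0 ((l , S) ∷ ws) (l≥0 , ws≥0) = ℚ.≤-trans (ℚ.≤-reflexive (begin
    φ (combo ((l , S) ∷ ws))
      ≡⟨ linear-combination₂ φ-lin l 1ℚ (pvec S) (combo ws) (λ c → cong (l * pvec S c +_) (sym (ℚ.*-identityˡ (combo ws c)))) ⟩
    l * φ (pvec S) + 1ℚ * φ (combo ws)
      ≡⟨ cong (l * φ (pvec S) +_) (ℚ.*-identityˡ (φ (combo ws))) ⟩
    l * φ (pvec S) + φ (combo ws)
      ∎))
    (ℚ.+-mono-≤ (ℚ.≤-trans (ℚ.*-monoˡ-≤-nonNeg l {{ℚ.nonNegative l≥0}} (vertices≤0 S)) (ℚ.≤-reflexive (ℚ.*-zeroʳ l)))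
                (combo≤0 ws ws≥0))

≤ᵇ-true : ∀ {x y} → x ℕ.≤ y → (x ≤ᵇ y) ≡ true
≤ᵇ-true {x} {y} = dec-true (x ℕ.≤? y)

≤ᵇ-false : ∀ {x y} → y ℕ.< x → (x ≤ᵇ y) ≡ false
≤ᵇ-false {x} {y} y<x = dec-false (x ℕ.≤? y) (ℕ.<⇒≱ y<x)

≡ᵇ-true : ∀ {x y} → x ≡ y → (x ≡ᵇ y) ≡ true
≡ᵇ-true {x} {y} = dec-true (x ℕ.≟ y)

≡ᵇ-false : ∀ {x y} → x ≢ y → (x ≡ᵇ y) ≡ false
≡ᵇ-false {x} {y} = dec-false (x ℕ.≟ y)

-- Immm22 m (ab i j) unfolds to  edge-coefficient (i + j ≤ᵇ m ∸ 1) (1 ≤ᵇ i ∧ 1 ≤ᵇ j ∧ i + j ≡ᵇ m).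
edge-coefficient : Bool → Bool → ℚ
edge-coefficient near antidiagonal = if near then 1ℚ else if antidiagonal then - 1ℚ else 0ℚ

Immm22-a-inject₁ : ∀ m (i : Fin m) → Immm22 (suc m) (a (inject₁ i)) ≡ Immm22 m (a i)
Immm22-a-inject₁ m zero    = refl
Immm22-a-inject₁ m (suc i) = refl

Immm22-first-column : ∀ {n} (i : Fin (suc n)) → Immm22 (suc n) (ab i zero) ≡ 1ℚ
Immm22-first-column {n} i =
  cong₂ edge-coefficient (≤ᵇ-true (subst (ℕ._≤ n) (sym (ℕ.+-identityʳ (toℕ i))) (ℕ.≤-pred (Fin.toℕ<n i)))) refl

Immm22-shift : ∀ {n} (i j : Fin (suc n)) → Immm22 (suc (suc n)) (ab (inject₁ i) (suc j)) ≡ Immm22 (suc n) (ab i j)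
Immm22-shift {n} i j = cong₂ edge-coefficient near-test antidiagonal-test
  where
  near-test : (toℕ (inject₁ i) ℕ.+ suc (toℕ j) ≤ᵇ suc n) ≡ (toℕ i ℕ.+ toℕ j ≤ᵇ n)
  near-test rewrite Fin.toℕ-inject₁ i | ℕ.+-suc (toℕ i) (toℕ j) with toℕ i ℕ.+ toℕ j
  ... | zero  = refl
  ... | suc _ = refl
  -- On the first column the antidiagonal test fails on both sides, since i ≤ n.
  first-column-test : ∀ j → (toℕ i ℕ.+ toℕ j ≡ᵇ suc n) ≡ ((1 ≤ᵇ toℕ j) ∧ (toℕ i ℕ.+ toℕ j ≡ᵇ suc n))
  first-column-test zero    = ≡ᵇ-false (λ e → ℕ.<⇒≢ (Fin.toℕ<n i) (trans (sym (ℕ.+-identityʳ (toℕ i))) e))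
  first-column-test (suc j) = refl
  antidiagonal-test : ((1 ≤ᵇ toℕ (inject₁ i)) ∧ true ∧ (toℕ (inject₁ i) ℕ.+ suc (toℕ j) ≡ᵇ suc (suc n)))
                    ≡ ((1 ≤ᵇ toℕ i) ∧ (1 ≤ᵇ toℕ j) ∧ (toℕ i ℕ.+ toℕ j ≡ᵇ suc n))
  antidiagonal-test rewrite Fin.toℕ-inject₁ i | ℕ.+-suc (toℕ i) (toℕ j) = cong ((1 ≤ᵇ toℕ i) ∧_) (first-column-test j)

Immm22-last-row-second : ∀ n → Immm22 (suc (suc n)) (ab (fromℕ (suc n)) (suc zero)) ≡ - 1ℚ
Immm22-last-row-second n = cong₂ edge-coefficient near-test antidiagonal-test
  where
  near-test : (toℕ (fromℕ (suc n)) ℕ.+ 1 ≤ᵇ suc n) ≡ false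
  near-test rewrite Fin.toℕ-fromℕ n = ≤ᵇ-false (ℕ.m<m+n (suc n) (s≤s z≤n))
  antidiagonal-test : ((1 ≤ᵇ toℕ (fromℕ (suc n))) ∧ true ∧ (toℕ (fromℕ (suc n)) ℕ.+ 1 ≡ᵇ suc (suc n))) ≡ true
  antidiagonal-test rewrite Fin.toℕ-fromℕ n = ≡ᵇ-true (ℕ.+-comm n 1)

Immm22-last-row-rest : ∀ n (j : Fin n) → Immm22 (suc (suc n)) (ab (fromℕ (suc n)) (suc (suc j))) ≡ 0ℚ
Immm22-last-row-rest n j = cong₂ edge-coefficient near-test antidiagonal-test
  where
  near-test : (toℕ (fromℕ (suc n)) ℕ.+ suc (suc (toℕ j)) ≤ᵇ suc n) ≡ false
  near-test rewrite Fin.toℕ-fromℕ n = ≤ᵇ-false (ℕ.m<m+n (suc n) (s≤s z≤n))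
  antidiagonal-test : ((1 ≤ᵇ toℕ (fromℕ (suc n))) ∧ true ∧ (toℕ (fromℕ (suc n)) ℕ.+ suc (suc (toℕ j)) ≡ᵇ suc (suc n))) ≡ false
  antidiagonal-test rewrite Fin.toℕ-fromℕ n | ℕ.+-suc n (suc (toℕ j)) | ℕ.+-suc n (toℕ j) =
    ≡ᵇ-false (ℕ.m≢1+m+n n ∘ sym)

embed : ∀ {m} → Coord m → Coord (suc m)
embed (a i)    = a (inject₁ i)
embed (b j)    = b (suc j)
embed (ab i j) = ab (inject₁ i) (suc j)

restrict : ∀ {m} → Point (suc m) → Point m
restrict x c = x (embed c)

boundary : ∀ n → Point (suc (suc n)) → ℚ
boundary n x = - ℕ→ℚ (suc n) * x (b zero) + sumFin (suc (suc n)) (λ i → x (ab i zero)) - x (ab (fromℕ (suc n)) (suc zero))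

a-terms-restrict : ∀ n (x : Point (suc (suc n))) →
  sumFin (suc (suc n)) (λ i → Immm22 (suc (suc n)) (a i) * x (a i)) ≡ sumFin (suc n) (λ i → Immm22 (suc n) (a i) * restrict x (a i))
a-terms-restrict n x = begin
  sumFin (suc m) (λ i → Immm22 (suc m) (a i) * x (a i))
    ≡⟨ sumFin-init-last m (λ i → Immm22 (suc m) (a i) * x (a i)) ⟩
  sumFin m (λ i → Immm22 (suc m) (a (inject₁ i)) * x (a (inject₁ i))) + 0ℚ * x (a (fromℕ m))
    ≡⟨ cong₂ _+_ (sumFin-cong m (λ i → cong (_* x (a (inject₁ i))) (Immm22-a-inject₁ m i))) (ℚ.*-zeroˡ (x (a (fromℕ m)))) ⟩
  sumFin m (λ i → Immm22 m (a i) * restrict x (a i)) + 0ℚ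
    ≡⟨ ℚ.+-identityʳ _ ⟩
  sumFin m (λ i → Immm22 m (a i) * restrict x (a i))
    ∎
  where
  m : ℕ
  m = suc n

ab-terms-restrict : ∀ n (x : Point (suc (suc n))) →
  sumFin (suc (suc n)) (λ i → sumFin (suc (suc n)) (λ j → Immm22 (suc (suc n)) (ab i j) * x (ab i j)))
  ≡ sumFin (suc n) (λ i → sumFin (suc n) (λ j → Immm22 (suc n) (ab i j) * restrict x (ab i j)))
    + (sumFin (suc (suc n)) (λ i → x (ab i zero)) - x (ab (fromℕ (suc n)) (suc zero)))
ab-terms-restrict n x = begin
  sumFin (suc m) (λ i → Immm22 (suc m) (ab i zero) * x (ab i zero) + rest i)
    ≡⟨ sumFin-cong (suc m) (λ i → cong (_+ rest i)
         (trans (cong (_* x (ab i zero)) (Immm22-first-column i)) (ℚ.*-identityˡ (x (ab i zero))))) ⟩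
  sumFin (suc m) (λ i → x (ab i zero) + rest i)
    ≡⟨ sumFin-+ (suc m) (λ i → x (ab i zero)) rest ⟩
  S + sumFin (suc m) rest
    ≡⟨ cong (S +_) (sumFin-init-last m rest) ⟩
  S + (sumFin m (init rest) + rest L)
    ≡⟨ cong (S +_) (cong₂ _+_
         (sumFin-cong m (λ i → sumFin-cong m (λ j → cong (_* x (ab (inject₁ i) (suc j))) (Immm22-shift i j))))
         last-rest) ⟩
  S + (AB + - l)
    ≡⟨ solve 3 (λ S AB l → S :+ (AB :+ (:- l)) := AB :+ (S :- l)) refl S AB l ⟩
  AB + (S - l)
    ∎
  where
  m : ℕ
  m = suc n
  L : Fin (suc m)
  L = fromℕ m
  S l AB : ℚ
  S = sumFin (suc m) (λ i → x (ab i zero))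
  l = x (ab L (suc zero))
  AB = sumFin m (λ i → sumFin m (λ j → Immm22 m (ab i j) * restrict x (ab i j)))
  rest : Fin (suc m) → ℚ
  rest i = sumFin m (λ j → Immm22 (suc m) (ab i (suc j)) * x (ab i (suc j)))
  last-rest : rest L ≡ - l
  last-rest = begin
    rest L
      ≡⟨ cong₂ (λ p q → p * l + q) (Immm22-last-row-second n)
               (sumFin-zero n (λ j → trans (cong (_* x (ab L (suc (suc j)))) (Immm22-last-row-rest n j))
                                           (ℚ.*-zeroˡ (x (ab L (suc (suc j))))))) ⟩
    - 1ℚ * l + 0ℚ
      ≡⟨ solve 1 (λ l → con (- 1ℚ) :* l :+ con 0ℚ := :- l) refl l ⟩
    - l
      ∎

lin-Immm22-restrict : ∀ n (x : Point (suc (suc n))) →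
  lin (suc (suc n)) (Immm22 (suc (suc n))) x ≡ lin (suc n) (Immm22 (suc n)) (restrict x) + boundary n x
lin-Immm22-restrict n x = begin
  lin (suc m) (Immm22 (suc m)) x
    ≡⟨ cong₂ (λ p q → p + (- N * x (b zero) + B) + q) (a-terms-restrict n x) (ab-terms-restrict n x) ⟩
  A + (- N * x (b zero) + B) + (AB + (S - l))
    ≡⟨ solve 7 (λ A B AB N β S l → A :+ ((:- N) :* β :+ B) :+ (AB :+ (S :- l)) := A :+ B :+ AB :+ ((:- N) :* β :+ S :- l))
             refl A B AB N (x (b zero)) S l ⟩
  lin m (Immm22 m) (restrict x) + boundary n x
    ∎
  where
  m : ℕ
  m = suc n
  N A B AB S l : ℚ
  N = ℕ→ℚ m
  A = sumFin m (λ i → Immm22 m (a i) * restrict x (a i))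
  B = sumFin m (λ j → Immm22 m (b j) * restrict x (b j))
  AB = sumFin m (λ i → sumFin m (λ j → Immm22 m (ab i j) * restrict x (ab i j)))
  S = sumFin (suc m) (λ i → x (ab i zero))
  l = x (ab (fromℕ m) (suc zero))

-- Values at vertices and validity

restrictS : ∀ {m} → NodeSubset (suc m) → NodeSubset m
restrictS (sA , sB) = init sA , tail sB

pvec-restrict : ∀ {m} (S : NodeSubset (suc m)) c → restrict (pvec S) c ≡ pvec (restrictS S) c
pvec-restrict S (a i)    = refl
pvec-restrict S (b j)    = refl
pvec-restrict S (ab i j) = refl

value : ∀ m → NodeSubset m → ℚ
value m S = lin m (Immm22 m) (pvec S)

value-cong : ∀ m (S T : NodeSubset m) → (∀ i → proj₁ S i ≡ proj₁ T i) → (∀ j → proj₂ S j ≡ proj₂ T j) →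
             value m S ≡ value m T
value-cong m S T sA≗tA sB≗tB = linear-cong (lin-linear m (Immm22 m)) (pvec S) (pvec T) λ
  { (a i)    → cong ind (sA≗tA i)
  ; (b j)    → cong ind (sB≗tB j)
  ; (ab i j) → cong ind (cong₂ _∧_ (sA≗tA i) (sB≗tB j)) }

value-restrict : ∀ n S → value (suc (suc n)) S ≡ value (suc n) (restrictS S) + boundary n (pvec S)
value-restrict n S = trans (lin-Immm22-restrict n (pvec S))
  (cong (_+ boundary n (pvec S)) (linear-cong (lin-linear (suc n) (Immm22 (suc n))) _ (pvec (restrictS S)) (pvec-restrict S)))

value-∅ : ∀ m → value m (const false , const false) ≡ 0ℚ
value-∅ m = linear-zero (lin-linear m (Immm22 m)) (pvec (const false , const false))
  λ { (a i) → refl ; (b j) → refl ; (ab i j) → refl }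

sumFin-ind-true : ∀ n {f : Fin n → Bool} → (∀ i → f i ≡ true) → sumFin n (λ i → ind (f i)) ≡ ℕ→ℚ n
sumFin-ind-true n f≗true = trans (sumFin-cong n (cong ind ∘ f≗true)) (trans (sumFin-const n 1ℚ) (ℚ.*-identityʳ (ℕ→ℚ n)))

sumFin-ind-all-but : ∀ n (k : Fin (suc n)) → sumFin (suc n) (λ i → ind (not (does (i Fin.≟ k)))) ≡ ℕ→ℚ n
sumFin-ind-all-but n k = begin
  sumFin (suc n) (λ i → ind (not (does (i Fin.≟ k))))
    ≡⟨ sumFin-remove n k (λ i → ind (not (does (i Fin.≟ k)))) ⟩
  ind (not (does (k Fin.≟ k))) + sumFin n (λ i → ind (not (does (punchIn k i Fin.≟ k))))
    ≡⟨ cong₂ _+_ (cong (ind ∘ not) (dec-true (k Fin.≟ k) refl))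
                 (sumFin-ind-true n {λ i → not (does (punchIn k i Fin.≟ k))}
                   (λ i → cong not (dec-false (punchIn k i Fin.≟ k) (Fin.punchInᵢ≢i k i)))) ⟩
  0ℚ + ℕ→ℚ n
    ≡⟨ ℚ.+-identityˡ (ℕ→ℚ n) ⟩
  ℕ→ℚ n
    ∎

sumFin-ind≤ : ∀ n (f : Fin n → Bool) → sumFin n (λ i → ind (f i)) ℚ.≤ ℕ→ℚ n
sumFin-ind≤ zero    f = ℚ.≤-refl
sumFin-ind≤ (suc n) f =
  ℚ.≤-trans (ℚ.+-mono-≤ (ind≤1 (f zero)) (sumFin-ind≤ n (tail f))) (ℚ.≤-reflexive (sym (ℕ→ℚ-suc n)))
  where
  ind≤1 : ∀ x → ind x ℚ.≤ 1ℚ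
  ind≤1 true  = ℚ.≤-refl
  ind≤1 false = 0≤ind true

boundary-without-B₁ : ∀ n (S : NodeSubset (suc (suc n))) → let sA , sB = S in sB zero ≡ false →
  boundary n (pvec S) ≡ - ind (sA (fromℕ (suc n)) ∧ sB (suc zero))
boundary-without-B₁ n (sA , sB) B₁∉S = begin
  - N * ind (sB zero) + sumFin (suc (suc n)) (λ i → ind (sA i ∧ sB zero)) - t
    ≡⟨ cong (λ β → - N * ind β + sumFin (suc (suc n)) (λ i → ind (sA i ∧ β)) - t) B₁∉S ⟩
  - N * 0ℚ + sumFin (suc (suc n)) (λ i → ind (sA i ∧ false)) - t
    ≡⟨ cong (λ s → - N * 0ℚ + s - t) (sumFin-zero (suc (suc n)) (λ i → cong ind (Bool.∧-zeroʳ (sA i)))) ⟩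
  - N * 0ℚ + 0ℚ - t
    ≡⟨ solve 2 (λ N t → (:- N) :* con 0ℚ :+ con 0ℚ :- t := :- t) refl N t ⟩
  - t
    ∎
  where
  N t : ℚ
  N = ℕ→ℚ (suc n)
  t = ind (sA (fromℕ (suc n)) ∧ sB (suc zero))

boundary-with-B₁ : ∀ n (S : NodeSubset (suc (suc n))) → let sA , sB = S in sB zero ≡ true →
  boundary n (pvec S) ≡ sumFin (suc (suc n)) (λ i → ind (sA i)) - ℕ→ℚ (suc n) - ind (sA (fromℕ (suc n)) ∧ sB (suc zero))
boundary-with-B₁ n (sA , sB) B₁∈S = begin
  - N * ind (sB zero) + sumFin (suc (suc n)) (λ i → ind (sA i ∧ sB zero)) - t
    ≡⟨ cong (λ β → - N * ind β + sumFin (suc (suc n)) (λ i → ind (sA i ∧ β)) - t) B₁∈S ⟩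
  - N * 1ℚ + sumFin (suc (suc n)) (λ i → ind (sA i ∧ true)) - t
    ≡⟨ cong (λ s → - N * 1ℚ + s - t) (sumFin-cong (suc (suc n)) (λ i → cong ind (Bool.∧-identityʳ (sA i)))) ⟩
  - N * 1ℚ + sumFin (suc (suc n)) (λ i → ind (sA i)) - t
    ≡⟨ solve 3 (λ N s t → (:- N) :* con 1ℚ :+ s :- t := s :- N :- t) refl N (sumFin (suc (suc n)) (λ i → ind (sA i))) t ⟩
  sumFin (suc (suc n)) (λ i → ind (sA i)) - N - t
    ∎
  where
  N t : ℚ
  N = ℕ→ℚ (suc n)
  t = ind (sA (fromℕ (suc n)) ∧ sB (suc zero))

value-all-A : ∀ n sB → value (suc n) (const true , sB) ≡ - 1ℚ + ind (sB zero)
value-all-A zero    sB =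
  trans (value-cong 1 (const true , sB) (const true , const (sB zero)) (λ _ → refl) λ { zero → refl }) (base (sB zero))
  where
  base : ∀ β → value 1 (const true , const β) ≡ - 1ℚ + ind β
  base true  = refl
  base false = refl
value-all-A (suc n) sB = begin
  value (suc (suc n)) (const true , sB)
    ≡⟨ value-restrict n (const true , sB) ⟩
  value (suc n) (const true , tail sB) + boundary n (pvec (const true , sB))
    ≡⟨ cong₂ _+_ (value-all-A n (tail sB)) (cong (λ s → - N * β₁ + s - β₂) (sumFin-const (suc (suc n)) β₁)) ⟩
  - 1ℚ + β₂ + (- N * β₁ + ℕ→ℚ (suc (suc n)) * β₁ - β₂)
    ≡⟨ cong (λ M → - 1ℚ + β₂ + (- N * β₁ + M * β₁ - β₂)) (ℕ→ℚ-suc (suc n)) ⟩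
  - 1ℚ + β₂ + (- N * β₁ + (1ℚ + N) * β₁ - β₂)
    ≡⟨ solve 3 (λ N β₁ β₂ → con (- 1ℚ) :+ β₂ :+ ((:- N) :* β₁ :+ (con 1ℚ :+ N) :* β₁ :- β₂) := con (- 1ℚ) :+ β₁)
             refl N β₁ β₂ ⟩
  - 1ℚ + β₁
    ∎
  where
  N β₁ β₂ : ℚ
  N = ℕ→ℚ (suc n)
  β₁ = ind (sB zero)
  β₂ = ind (sB (suc zero))

boundary-≤-missing-A : ∀ n (S : NodeSubset (suc (suc n))) → let sA , sB = S in
                       sB zero ≡ true → ∀ p → sA p ≡ false → boundary n (pvec S) ℚ.≤ 0ℚ
boundary-≤-missing-A n (sA , sB) B₁∈S p Aₚ∉S =
  ℚ.≤-trans (ℚ.≤-reflexive (boundary-with-B₁ n (sA , sB) B₁∈S))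
    (ℚ.+-mono-≤ (ℚ.≤-trans (ℚ.+-monoˡ-≤ (- N) count≤N) (ℚ.≤-reflexive (ℚ.+-inverseʳ N)))
                (ℚ.neg-antimono-≤ (0≤ind (sA (fromℕ (suc n)) ∧ sB (suc zero)))))
  where
  N : ℚ
  N = ℕ→ℚ (suc n)
  rest : ℚ
  rest = sumFin (suc n) (removeAt (λ i → ind (sA i)) p)
  count≤N : sumFin (suc (suc n)) (λ i → ind (sA i)) ℚ.≤ N
  count≤N = ℚ.≤-trans
    (ℚ.≤-reflexive (trans (sumFin-remove (suc n) p (λ i → ind (sA i))) (trans (cong (λ α → ind α + rest) Aₚ∉S) (ℚ.+-identityˡ rest))))
    (sumFin-ind≤ (suc n) (removeAt sA p))

valid-vertex : ∀ n S → value (suc n) S ℚ.≤ 0ℚ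
valid-vertex zero (sA , sB) =
  subst (ℚ._≤ 0ℚ) (value-cong 1 (sA , sB) (const (sA zero) , const (sB zero)) (λ { zero → refl }) (λ { zero → refl }))
    (base (sA zero) (sB zero))
  where
  base : ∀ α β → value 1 (const α , const β) ℚ.≤ 0ℚ
  base true  true  = ℚ.≤-refl
  base true  false = ℚ.*≤* ℤ.-≤+
  base false true  = ℚ.≤-refl
  base false false = ℚ.≤-refl
valid-vertex (suc n) (sA , sB) = by-B₁ (sB zero) refl
  where
  by-B₁ : ∀ β → sB zero ≡ β → value (suc (suc n)) (sA , sB) ℚ.≤ 0ℚ
  by-B₁ false B₁∉S =
    ℚ.≤-trans (ℚ.≤-reflexive (trans (value-restrict n (sA , sB))
                                    (cong (value (suc n) (restrictS (sA , sB)) +_) (boundary-without-B₁ n (sA , sB) B₁∉S))))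
      (ℚ.+-mono-≤ (valid-vertex n (restrictS (sA , sB))) (ℚ.neg-antimono-≤ (0≤ind (sA (fromℕ (suc n)) ∧ sB (suc zero)))))
  by-B₁ true B₁∈S with Fin.all? (λ i → sA i Bool.≟ true)
  ... | yes all-A = ℚ.≤-reflexive (begin
    value (suc (suc n)) (sA , sB)         ≡⟨ value-cong (suc (suc n)) (sA , sB) (const true , sB) all-A (λ _ → refl) ⟩
    value (suc (suc n)) (const true , sB) ≡⟨ value-all-A (suc n) sB ⟩
    - 1ℚ + ind (sB zero)                  ≡⟨ cong (λ β → - 1ℚ + ind β) B₁∈S ⟩
    0ℚ                                    ∎)
  ... | no ¬all-A =
    let p , Aₚ≢true = Fin.¬∀⟶∃¬ (suc (suc n)) _ (λ i → sA i Bool.≟ true) ¬all-A in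
    ℚ.≤-trans (ℚ.≤-reflexive (value-restrict n (sA , sB)))
      (ℚ.+-mono-≤ (valid-vertex n (restrictS (sA , sB))) (boundary-≤-missing-A n (sA , sB) B₁∈S p (Bool.¬-not Aₚ≢true)))

-- Tight vertices

lift : ∀ {m} → NodeSubset m → NodeSubset (suc m)
lift (sA , sB) = snoc sA false , false Vec.∷ sB

pvec-lift-embed : ∀ {m} (S : NodeSubset m) c → pvec (lift S) (embed c) ≡ pvec S c
pvec-lift-embed (sA , sB) (a i)    = cong ind (snoc-inject₁ sA false i)
pvec-lift-embed (sA , sB) (b j)    = refl
pvec-lift-embed (sA , sB) (ab i j) = cong (λ α → ind (α ∧ sB j)) (snoc-inject₁ sA false i)

value-lift : ∀ n S → value (suc (suc n)) (lift S) ≡ value (suc n) S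
value-lift n (sA , sB) = begin
  value (suc (suc n)) (lift (sA , sB))
    ≡⟨ value-restrict n (lift (sA , sB)) ⟩
  value (suc n) (init (snoc sA false) , sB) + boundary n (pvec (lift (sA , sB)))
    ≡⟨ cong₂ _+_ (value-cong (suc n) (restrictS (lift (sA , sB))) (sA , sB) (snoc-inject₁ sA false) (λ _ → refl))
                 (trans (boundary-without-B₁ n (lift (sA , sB)) refl)
                        (cong (λ α → - ind (α ∧ sB zero)) (snoc-last sA false))) ⟩
  value (suc n) (sA , sB) + 0ℚ
    ≡⟨ ℚ.+-identityʳ _ ⟩
  value (suc n) (sA , sB)
    ∎

first-A : ∀ {n} → NodeSubset (suc n)
first-A = true Vec.∷ const false , const false

value-first-A : ∀ n → value (suc n) first-A ≡ - 1ℚ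
value-first-A zero    = refl
value-first-A (suc n) = begin
  value (suc (suc n)) first-A
    ≡⟨ value-restrict n first-A ⟩
  value (suc n) (restrictS first-A) + boundary n (pvec first-A)
    ≡⟨ cong₂ _+_ (trans (value-cong (suc n) (restrictS first-A) first-A
                                    (λ { zero → refl ; (suc i) → refl }) (λ _ → refl))
                        (value-first-A n))
                 (boundary-without-B₁ n first-A refl) ⟩
  - 1ℚ + 0ℚ
    ≡⟨⟩
  - 1ℚ
    ∎

Z : ∀ m → Fin (suc m) → NodeSubset m
Z m k = (λ i → not (does (inject₁ i Fin.≟ k))) , (λ j → does (toℕ j ℕ.+ toℕ k ℕ.≟ m))

boundary-Z-inject₁ : ∀ n (k : Fin (suc (suc n))) → boundary n (pvec (Z (suc (suc n)) (inject₁ k))) ≡ 0ℚ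
boundary-Z-inject₁ n k = begin
  boundary n (pvec (Z (suc (suc n)) (inject₁ k)))
    ≡⟨ boundary-without-B₁ n (Z (suc (suc n)) (inject₁ k)) (dec-false (toℕ (inject₁ k) ℕ.≟ suc (suc n)) toℕk≢2+n) ⟩
  - ind (not (does (inject₁ L Fin.≟ inject₁ k)) ∧ does (toℕ (inject₁ k) ℕ.≟ suc n))
    ≡⟨ cong (λ β → - ind β) (≢∧toℕ≡-false (inject₁ L) (inject₁ k) (trans (Fin.toℕ-inject₁ L) (Fin.toℕ-fromℕ (suc n)))) ⟩
  0ℚ
    ∎
  where
  L : Fin (suc (suc n))
  L = fromℕ (suc n)
  toℕk≢2+n : toℕ (inject₁ k) ≢ suc (suc n)
  toℕk≢2+n = ℕ.<⇒≢ (Fin.toℕ<n k) ∘ trans (sym (Fin.toℕ-inject₁ k))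

boundary-Z-last : ∀ n → boundary n (pvec (Z (suc (suc n)) (fromℕ (suc (suc n))))) ≡ 1ℚ
boundary-Z-last n = begin
  boundary n (pvec (Z (suc (suc n)) L))
    ≡⟨ boundary-with-B₁ n (Z (suc (suc n)) L) (dec-true (toℕ L ℕ.≟ suc (suc n)) (Fin.toℕ-fromℕ (suc (suc n)))) ⟩
  sumFin (suc (suc n)) (λ i → ind (not (does (inject₁ i Fin.≟ L)))) - N - ind (A-last ∧ does (suc (toℕ L) ℕ.≟ suc (suc n)))
    ≡⟨ cong₂ (λ s β → s - N - ind (A-last ∧ β))
             (sumFin-ind-true (suc (suc n)) (λ i → cong not (dec-false (inject₁ i Fin.≟ L) (Fin.fromℕ≢inject₁ ∘ sym))))
             (dec-false (suc (toℕ L) ℕ.≟ suc (suc n)) (λ e → ℕ.1+n≢n (trans e (sym (Fin.toℕ-fromℕ (suc (suc n))))))) ⟩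
  ℕ→ℚ (suc (suc n)) - N - ind (A-last ∧ false)
    ≡⟨ cong (λ β → ℕ→ℚ (suc (suc n)) - N - ind β) (Bool.∧-zeroʳ A-last) ⟩
  ℕ→ℚ (suc (suc n)) - N - 0ℚ
    ≡⟨ cong (λ s → s - N - 0ℚ) (ℕ→ℚ-suc (suc n)) ⟩
  1ℚ + N - N - 0ℚ
    ≡⟨ solve 1 (λ N → con 1ℚ :+ N :- N :- con 0ℚ := con 1ℚ) refl N ⟩
  1ℚ
    ∎
  where
  L : Fin (suc (suc (suc n)))
  L = fromℕ (suc (suc n))
  N : ℚ
  N = ℕ→ℚ (suc n)
  A-last : Bool
  A-last = not (does (inject₁ (fromℕ (suc n)) Fin.≟ L))

value-restrict-Z-inject₁ : ∀ n k → value (suc n) (restrictS (Z (suc (suc n)) (inject₁ k))) ≡ value (suc n) (Z (suc n) k)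
value-restrict-Z-inject₁ n k =
  value-cong (suc n) (restrictS (Z (suc (suc n)) (inject₁ k))) (Z (suc n) k)
    (λ i → cong not (does-inject₁-≟ (inject₁ i) k))
    (λ j → cong (λ t → does (toℕ j ℕ.+ t ℕ.≟ suc n)) (Fin.toℕ-inject₁ k))

value-restrict-Z-last : ∀ n → value (suc n) (restrictS (Z (suc (suc n)) (fromℕ (suc (suc n))))) ≡ - 1ℚ
value-restrict-Z-last n =
  trans (value-cong (suc n) (restrictS (Z (suc (suc n)) L)) (const true , const false) A-all B-none) (value-all-A n (const false))
  where
  L : Fin (suc (suc (suc n)))
  L = fromℕ (suc (suc n))
  A-all : ∀ i → not (does (inject₁ (inject₁ i) Fin.≟ L)) ≡ true
  A-all i = cong not (dec-false (inject₁ (inject₁ i) Fin.≟ L) (Fin.fromℕ≢inject₁ ∘ sym))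
  1+n<L : suc n ℕ.< toℕ L
  1+n<L = subst (suc n ℕ.<_) (sym (Fin.toℕ-fromℕ (suc (suc n)))) (ℕ.n<1+n (suc n))
  B-none : ∀ j → does (toℕ j ℕ.+ toℕ L ℕ.≟ suc n) ≡ false
  B-none j = dec-false (toℕ j ℕ.+ toℕ L ℕ.≟ suc n) (λ e → ℕ.<⇒≢ (ℕ.<-≤-trans 1+n<L (ℕ.m≤n+m (toℕ L) (toℕ j))) (sym e))

value-Z : ∀ n k → value (suc n) (Z (suc n) k) ≡ 0ℚ
value-Z zero    zero       = refl
value-Z zero    (suc zero) = refl
value-Z (suc n) k with last-or-inject₁ k
... | inject₁-view k′ =
  trans (value-restrict n (Z (suc (suc n)) (inject₁ k′)))
        (cong₂ _+_ (trans (value-restrict-Z-inject₁ n k′) (value-Z n k′)) (boundary-Z-inject₁ n k′))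
... | last-view =
  trans (value-restrict n (Z (suc (suc n)) (fromℕ (suc (suc n)))))
        (cong₂ _+_ (value-restrict-Z-last n) (boundary-Z-last n))

row : ∀ m → Fin (suc m) → NodeSubset (suc m)
row m k = (λ i → not (does (i Fin.≟ k))) , (true Vec.∷ proj₂ (Z m k))

value-row : ∀ n k → value (suc (suc n)) (row (suc n) k) ≡ 0ℚ
value-row n k = begin
  value (suc (suc n)) (row (suc n) k)
    ≡⟨ value-restrict n (row (suc n) k) ⟩
  value (suc n) (Z (suc n) k) + boundary n (pvec (row (suc n) k))
    ≡⟨ cong₂ _+_ (value-Z n k) (boundary-with-B₁ n (row (suc n) k) refl) ⟩
  0ℚ + (sumFin (suc (suc n)) (λ i → ind (not (does (i Fin.≟ k))))
         - N - ind (not (does (fromℕ (suc n) Fin.≟ k)) ∧ does (toℕ k ℕ.≟ suc n)))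
    ≡⟨ cong₂ (λ s β → 0ℚ + (s - N - ind β))
             (sumFin-ind-all-but (suc n) k) (≢∧toℕ≡-false (fromℕ (suc n)) k (Fin.toℕ-fromℕ (suc n))) ⟩
  0ℚ + (N - N - 0ℚ)
    ≡⟨ solve 1 (λ N → con 0ℚ :+ (N :- N :- con 0ℚ) := con 0ℚ) refl N ⟩
  0ℚ
    ∎
  where
  N : ℚ
  N = ℕ→ℚ (suc n)

column : ∀ m → Fin m → NodeSubset (suc m)
column m j = const true , (true Vec.∷ λ j′ → does (j′ Fin.≟ j))

all-A-with-B₁ : ∀ {m} → NodeSubset (suc m)
all-A-with-B₁ = const true , (true Vec.∷ const false)

last-A : ∀ {m} → NodeSubset (suc m)
last-A = snoc (const false) true , const false

value-last-A : ∀ n → value (suc (suc n)) last-A ≡ 0ℚ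
value-last-A n = begin
  value (suc (suc n)) last-A
    ≡⟨ value-restrict n last-A ⟩
  value (suc n) (restrictS last-A) + boundary n (pvec last-A)
    ≡⟨ cong₂ _+_
         (trans (value-cong (suc n) (restrictS last-A) (const false , const false) (snoc-inject₁ (const false) true) (λ _ → refl))
                (value-∅ (suc n)))
         (trans (boundary-without-B₁ n last-A refl) (cong (λ β → - ind β) (Bool.∧-zeroʳ (snoc (const false) true (fromℕ (suc n)))))) ⟩
  0ℚ + 0ℚ
    ≡⟨ ℚ.+-identityʳ 0ℚ ⟩
  0ℚ
    ∎

tight-count : ℕ → ℕ
tight-count zero    = 2
tight-count (suc n) = suc (suc n) ℕ.+ (suc n ℕ.+ (2 ℕ.+ tight-count n))

specials : ∀ {m} → Vector (NodeSubset (suc m)) 2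
specials = all-A-with-B₁ Vec.∷ last-A Vec.∷ Vec.[]

tight : ∀ n → Vector (NodeSubset (suc n)) (tight-count n)
tight zero    = (const true , const true) Vec.∷ (const false , const true) Vec.∷ Vec.[]
tight (suc n) = row (suc n) ++ (column (suc n) ++ (specials ++ (lift ∘ tight n)))

tight-value : ∀ n i → value (suc n) (tight n i) ≡ 0ℚ
tight-value zero    zero       = refl
tight-value zero    (suc zero) = refl
tight-value (suc n) =
  ++-all {P = vanishes} (row (suc n)) _ (value-row n)
    (++-all {P = vanishes} (column (suc n)) _ (λ j → value-all-A (suc n) (proj₂ (column (suc n) j)))
      (++-all {P = vanishes} specials (lift ∘ tight n) special-value (λ i → trans (value-lift n (tight n i)) (tight-value n i))))
  where
  vanishes : NodeSubset (suc (suc n)) → Set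
  vanishes S = value (suc (suc n)) S ≡ 0ℚ
  special-value : ∀ t → value (suc (suc n)) (specials t) ≡ 0ℚ
  special-value zero       = value-all-A (suc n) (true Vec.∷ const false)
  special-value (suc zero) = value-last-A n

tight-count-closed : ∀ n → suc (tight-count n) ≡ suc n ℕ.+ (suc n ℕ.+ suc n ℕ.* suc n)
tight-count-closed zero    = refl
tight-count-closed (suc n) = begin
  suc (suc (suc n) ℕ.+ (suc n ℕ.+ (2 ℕ.+ tight-count n)))
    ≡⟨ cong (λ t → suc (suc (suc n) ℕ.+ (suc n ℕ.+ suc t))) (tight-count-closed n) ⟩
  suc (suc (suc n) ℕ.+ (suc n ℕ.+ suc (suc n ℕ.+ (suc n ℕ.+ suc n ℕ.* suc n))))
    ≡⟨ solveℕ 1 (λ k → κ 1 ⊕ ((κ 2 ⊕ k) ⊕ ((κ 1 ⊕ k) ⊕ (κ 1 ⊕ ((κ 1 ⊕ k) ⊕ ((κ 1 ⊕ k) ⊕ (κ 1 ⊕ k) ⊗ (κ 1 ⊕ k))))))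
                      ≐ (κ 2 ⊕ k) ⊕ ((κ 2 ⊕ k) ⊕ (κ 2 ⊕ k) ⊗ (κ 2 ⊕ k))) refl n ⟩
  suc (suc n) ℕ.+ (suc (suc n) ℕ.+ suc (suc n) ℕ.* suc (suc n))
    ∎
  where
  open ℕ-Solver.+-*-Solver using () renaming (solve to solveℕ; _:+_ to _⊕_; _:*_ to _⊗_; _:=_ to _≐_; con to κ)

-- Linear independence of the tight vertices

row-functional : ∀ {m} → Fin (suc m) → Point (suc m) → ℚ
row-functional k x = x (b zero) - x (ab k zero)

column-functional : ∀ {m} → Fin m → Point (suc m) → ℚ
column-functional {m} j x = x (ab (fromℕ m) (suc j))

special-functional : ∀ {m} → Vector (Point (suc m) → ℚ) 2
special-functional {m} = (λ x → x (b zero)) Vec.∷ (λ x → x (a (fromℕ m))) Vec.∷ Vec.[]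

row-functional-without-B₁ : ∀ {m} k (S : NodeSubset (suc m)) → proj₂ S zero ≡ false → row-functional k (pvec S) ≡ 0ℚ
row-functional-without-B₁ k (sA , sB) B₁∉S rewrite B₁∉S = cong (λ β → 0ℚ - ind β) (Bool.∧-zeroʳ (sA k))

rows-independent : ∀ n {s} {ws : Vector (Point (suc (suc n))) s} → (∀ k i → row-functional k (ws i) ≡ 0ℚ) →
                   LinearlyIndependent s ws → LinearlyIndependent (suc (suc n) ℕ.+ s) ((pvec ∘ row (suc n)) ++ ws)
rows-independent n =
  independent-++ row-functional (λ k → −-linear (evaluation-linear (b zero)) (evaluation-linear (ab k zero))) diagonal above
  where
  on-row : ∀ k k′ → row-functional k (pvec (row (suc n) k′)) ≡ 1ℚ - ind (not (does (k Fin.≟ k′)))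
  on-row k k′ = cong (λ β → 1ℚ - ind β) (Bool.∧-identityʳ (not (does (k Fin.≟ k′))))
  diagonal : ∀ k → row-functional k (pvec (row (suc n) k)) ≢ 0ℚ
  diagonal k e = 1≢0 (trans (sym (trans (on-row k k) (cong (λ β → 1ℚ - ind (not β)) (dec-true (k Fin.≟ k) refl)))) e)
  above : ∀ {k k′} → k Fin.< k′ → row-functional k (pvec (row (suc n) k′)) ≡ 0ℚ
  above {k} {k′} k<k′ = trans (on-row k k′) (cong (λ β → 1ℚ - ind (not β)) (dec-false (k Fin.≟ k′) (Fin.<⇒≢ k<k′)))

columns-independent : ∀ n {s} {ws : Vector (Point (suc (suc n))) s} → (∀ j i → column-functional j (ws i) ≡ 0ℚ) →
                      LinearlyIndependent s ws → LinearlyIndependent (suc n ℕ.+ s) ((pvec ∘ column (suc n)) ++ ws)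
columns-independent n = independent-++ column-functional (λ j → evaluation-linear (ab (fromℕ (suc n)) (suc j))) diagonal above
  where
  diagonal : ∀ j → column-functional j (pvec (column (suc n) j)) ≢ 0ℚ
  diagonal j e = 1≢0 (trans (sym (cong ind (dec-true (j Fin.≟ j) refl))) e)
  above : ∀ {j j′} → j Fin.< j′ → column-functional j (pvec (column (suc n) j′)) ≡ 0ℚ
  above {j} {j′} j<j′ = cong ind (dec-false (j Fin.≟ j′) (Fin.<⇒≢ j<j′))

specials-independent : ∀ n {s} {ws : Vector (Point (suc (suc n))) s} → (∀ t i → special-functional t (ws i) ≡ 0ℚ) →
                       LinearlyIndependent s ws → LinearlyIndependent (2 ℕ.+ s) ((pvec ∘ specials) ++ ws)
specials-independent n = independent-++ special-functional special-linear diagonal above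
  where
  special-linear : ∀ t → Linear (special-functional {suc n} t)
  special-linear zero       = evaluation-linear (b zero)
  special-linear (suc zero) = evaluation-linear (a (fromℕ (suc n)))
  diagonal : ∀ t → special-functional t (pvec (specials t)) ≢ 0ℚ
  diagonal zero       ()
  diagonal (suc zero) e = 1≢0 (trans (sym (cong ind (snoc-last {n = suc n} (const false) true))) e)
  above : ∀ {t t′} → t Fin.< t′ → special-functional {suc n} t (pvec (specials t′)) ≡ 0ℚ
  above {zero}     {suc zero} _          = refl
  above {suc zero} {suc zero} (s≤s ())

tight-independent : ∀ n → LinearlyIndependent (tight-count n) (pvec ∘ tight n)
tight-independent zero =
  independent-∷ {v = pvec (const true , const true)} {ws = pvec (const false , const true) Vec.∷ Vec.[]}
    (evaluation-linear (a zero)) 1≢0 (λ { zero → refl ; (suc ()) })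
    (independent-∷ {v = pvec (const false , const true)} {ws = Vec.[]} (evaluation-linear (b zero)) 1≢0 (λ ()) (λ _ _ ()))
tight-independent (suc n) =
  independent-resp (λ i c → cong (λ x → x c) (sym (pvec-tight i)))
    (rows-independent n
      (λ k → ++-all {P = λ x → row-functional k x ≡ 0ℚ} (pvec ∘ column m) _ (λ _ → refl)
               (++-all {P = λ x → row-functional k x ≡ 0ℚ} (pvec ∘ specials) _ (row-special k)
                 (λ i → row-functional-without-B₁ k (lift (tight n i)) refl)))
      (columns-independent n
        (λ j → ++-all {P = λ x → column-functional j x ≡ 0ℚ} (pvec ∘ specials) _ (column-special j) (column-lifted j))
        (specials-independent n special-lifted
          (independent-restriction embed (λ i → pvec-lift-embed (tight n i)) (tight-independent n)))))
  where
  m : ℕ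
  m = suc n
  pvec-tight : ∀ i → pvec (tight m i) ≡ ((pvec ∘ row m) ++ ((pvec ∘ column m) ++ ((pvec ∘ specials) ++ (pvec ∘ lift ∘ tight n)))) i
  pvec-tight i = trans (map-++ pvec (row m) _ i)
    (++-cong (pvec ∘ row m) _ (λ _ → refl)
      (λ j → trans (map-++ pvec (column m) _ j)
                   (++-cong (pvec ∘ column m) _ (λ _ → refl) (map-++ pvec specials (lift ∘ tight n)) j)) i)
  row-special : ∀ k t → row-functional k (pvec (specials t)) ≡ 0ℚ
  row-special k zero       = refl
  row-special k (suc zero) = row-functional-without-B₁ k last-A refl
  column-special : ∀ j t → column-functional j (pvec (specials t)) ≡ 0ℚ
  column-special j zero       = refl
  column-special j (suc zero) = cong ind (Bool.∧-zeroʳ (snoc (const false) true (fromℕ m)))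
  column-lifted : ∀ j i → column-functional j (pvec (lift (tight n i))) ≡ 0ℚ
  column-lifted j i = cong (λ α → ind (α ∧ proj₂ (tight n i) j)) (snoc-last (proj₁ (tight n i)) false)
  special-lifted : ∀ t i → special-functional t (pvec (lift (tight n i))) ≡ 0ℚ
  special-lifted zero       i = refl
  special-lifted (suc zero) i = cong ind (snoc-last (proj₁ (tight n i)) false)

face-points : ∀ n → HasAffIndep (λ x → InCOR (suc n) x × lin (suc n) (Immm22 (suc n)) x ≡ 0ℚ) (tight-count n)
face-points n =
  origin Vec.∷ (pvec ∘ tight n) ,
  (λ { zero    → vertex-in-COR (const false , const false) , value-∅ (suc n)
     ; (suc i) → vertex-in-COR (tight n i) , tight-value n i }) ,
  affine-from-origin origin (pvec ∘ tight n) (λ { (a i) → refl ; (b j) → refl ; (ab i j) → refl }) (tight-independent n)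
  where
  origin : Point (suc n)
  origin = pvec (const false , const false)

theorem6 : (m : ℕ) → m ≥ 1 → IsFacetCOR m (Immm22 m)
theorem6 (suc n) _ =
  valid-on-COR (lin-linear m (Immm22 m)) (valid-vertex n) ,
  tight-count n ,
  hyperplane-section-dimensions (InCOR m) (tight-count n) (lin-linear m (Immm22 m))
    (pvec first-A) (vertex-in-COR first-A) (λ e → -1≢0 (trans (sym (value-first-A n)) e))
    (affine-dimension-bound (InCOR m) _ (subst (ℕ._< suc (suc (tight-count n))) (tight-count-closed n) ℕ.≤-refl))
    (face-points n)
  where
  m : ℕ
  m = suc n
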